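{- Let $\Gamma=(V,E)$ be a finite, simple, connected graph of valency $2r$ for some prime $r$, and let $G\le\mathrm{Aut}\,\Gamma$ be transitive on $V$ and $E$ but not transitive on the set of $2$-arcs of $\Gamma$. Suppose $\Gamma$ is $G$-arc-transitive, and let $N$ be a normal subgroup of $G$ that is transitive on $V$; let $\alpha\in V$. Then one of the following holds: (1) either $N_\alpha$ is a $2$-group, or $N$ is transitive on $E$; (2) $E$ has a partition $E=E_1\cup E_2$ such that $(E_1,E_2)^g=(E_2,E_1)$ for some $g\in G\setminus N$, and $(V,E_1)$, $(V,E_2)$ are $N$-arc-transitive graphs of valency $r$.
   Context: A $2$-arc is a triple $(\alpha,\beta,\gamma)$ of vertices with $\alpha\ne\gamma$ and $\{\alpha,\beta\},\{\beta,\gamma\}\in E$; arcs are ordered pairs $(\alpha,\beta)$ with $\{\alpha,\beta\}\in E$. $N_\alpha$ is the stabilizer of $\alpha$ in $N$. -}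

module Defs where

open import Data.Nat.Base using (ℕ; _*_; _^_)
open import Data.Bool.Base using (Bool; true; false; not; _∧_)
open import Data.Fin.Base using (Fin)
open import Data.Bool.Properties renaming (_≟_ to _B≟_) using ()
open import Data.Fin.Properties using (_≟_)
open import Data.Fin.Permutation using (Permutation′; _⟨$⟩ʳ_; _⟨$⟩ˡ_; _≈_; id; flip; _∘ₚ_)
open import Data.List.Base using (List; length; filter; allFin)
open import Data.List.Relation.Unary.Any using (Any)
open import Data.List.Relation.Unary.All using (All)
open import Data.List.Relation.Unary.AllPairs using (AllPairs)
open import Data.Product.Base using (Σ; ∃; _×_; _,_)
open import Data.Sum.Base using (_⊎_)
open import Relation.Binary.PropositionalEquality using (_≡_; _≢_)
open import Relation.Binary.Construct.Closure.ReflexiveTransitive using (Star)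
open import Relation.Nullary using (¬_)

-- Permutations of the vertex set Fin n.  g acts by  g ⟨$⟩ʳ v.
Perm : ℕ → Set
Perm n = Permutation′ n

infix 4 _∈ₚ_
_∈ₚ_ : ∀ {n} → Perm n → List (Perm n) → Set
g ∈ₚ gs = Any (λ h → h ≈ g) gs

Adj : ℕ → Set
Adj n = Fin n → Fin n → Bool

record IsSimpleGraph {n : ℕ} (adj : Adj n) : Set where
  field
    symmetric   : ∀ u v → adj u v ≡ adj v u
    irreflexive : ∀ u → adj u u ≡ false

Edge' : ∀ {n} → Adj n → Fin n → Fin n → Set
Edge' adj u v = adj u v ≡ true

Connected : ∀ {n} → Adj n → Set
Connected adj = ∀ u v → Star (Edge' adj) u v

nbrs : ∀ {n} → Adj n → Fin n → List (Fin n)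
nbrs {n} adj u = filter (λ v → adj u v B≟ true) (allFin n)

Regular : ∀ {n} → Adj n → ℕ → Set
Regular adj k = ∀ u → length (nbrs adj u) ≡ k

IsAutomorphism : ∀ {n} → Adj n → Perm n → Set
IsAutomorphism adj g = ∀ u v → adj (g ⟨$⟩ʳ u) (g ⟨$⟩ʳ v) ≡ adj u v

record IsPermGroup {n : ℕ} (G : List (Perm n)) : Set where
  field
    distinct : AllPairs (λ g h → ¬ (g ≈ h)) G
    has-id   : id ∈ₚ G
    closed-∘ : ∀ {g h} → g ∈ₚ G → h ∈ₚ G → (g ∘ₚ h) ∈ₚ G
    closed-⁻¹ : ∀ {g} → g ∈ₚ G → flip g ∈ₚ G

_⊆ₚ_ : ∀ {n} → List (Perm n) → List (Perm n) → Set
H ⊆ₚ G = ∀ {h} → h ∈ₚ H → h ∈ₚ G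

record IsNormalSubgroup {n : ℕ} (N G : List (Perm n)) : Set where
  field
    group     : IsPermGroup N
    subset    : N ⊆ₚ G
    conjugate : ∀ {g h} → g ∈ₚ G → h ∈ₚ N → (flip g ∘ₚ h ∘ₚ g) ∈ₚ N

AutGroup : ∀ {n} → Adj n → List (Perm n) → Set
AutGroup adj G = IsPermGroup G × (∀ {g} → g ∈ₚ G → IsAutomorphism adj g)

VertexTransitive : ∀ {n} → List (Perm n) → Set
VertexTransitive {n} G =
  ∀ (u v : Fin n) → ∃ λ g → g ∈ₚ G × g ⟨$⟩ʳ u ≡ v

-- edges are unordered pairs {u,v} with u ~ v;  {g u, g v} = {x, y}
EdgeTransitive : ∀ {n} → Adj n → List (Perm n) → Set
EdgeTransitive {n} adj G =
  ∀ (u v x y : Fin n) → adj u v ≡ true → adj x y ≡ true →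
  ∃ λ g → g ∈ₚ G ×
    ((g ⟨$⟩ʳ u ≡ x × g ⟨$⟩ʳ v ≡ y) ⊎ (g ⟨$⟩ʳ u ≡ y × g ⟨$⟩ʳ v ≡ x))

ArcTransitive : ∀ {n} → Adj n → List (Perm n) → Set
ArcTransitive {n} adj G =
  ∀ (u v x y : Fin n) → adj u v ≡ true → adj x y ≡ true →
  ∃ λ g → g ∈ₚ G × g ⟨$⟩ʳ u ≡ x × g ⟨$⟩ʳ v ≡ y

TwoArcTransitive : ∀ {n} → Adj n → List (Perm n) → Set
TwoArcTransitive {n} adj G =
  ∀ (a b c x y z : Fin n) →
  adj a b ≡ true → adj b c ≡ true → a ≢ c →
  adj x y ≡ true → adj y z ≡ true → x ≢ z →
  ∃ λ g → g ∈ₚ G × g ⟨$⟩ʳ a ≡ x × g ⟨$⟩ʳ b ≡ y × g ⟨$⟩ʳ c ≡ z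

IsXArcTransitiveGraph : ∀ {n} → Adj n → List (Perm n) → Set
IsXArcTransitiveGraph adj X =
  (∀ {g} → g ∈ₚ X → IsAutomorphism adj g) × ArcTransitive adj X

stabiliser : ∀ {n} → List (Perm n) → Fin n → List (Perm n)
stabiliser N α = filter (λ g → (g ⟨$⟩ʳ α) ≟ α) N

-- a finite group given as a duplicate-free list is a 2-group iff its order is 2^k
Is2Group : ∀ {n} → List (Perm n) → Set
Is2Group H = ∃ λ k → length H ≡ 2 ^ k

-- Edge partitions E = E₁ ∪ E₂, encoded by a symmetric 2-colouring c of
-- the edges: E₁ = {{u,v} ∈ E | c u v = true}, E₂ = {{u,v} ∈ E | c u v = false}

E₁-adj : ∀ {n} → Adj n → (Fin n → Fin n → Bool) → Adj n
E₁-adj adj c u v = adj u v ∧ c u v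

E₂-adj : ∀ {n} → Adj n → (Fin n → Fin n → Bool) → Adj n
E₂-adj adj c u v = adj u v ∧ not (c u v)

-- c is a well-defined colouring of unordered edges
SymmetricColouring : ∀ {n} → Adj n → (Fin n → Fin n → Bool) → Set
SymmetricColouring adj c = ∀ u v → adj u v ≡ true → c u v ≡ c v u

SwapsParts : ∀ {n} → Adj n → (Fin n → Fin n → Bool) → Perm n → Set
SwapsParts adj c g =
  ∀ u v → adj u v ≡ true → c (g ⟨$⟩ʳ u) (g ⟨$⟩ʳ v) ≡ not (c u v)

module Submission where

-- N_α permutes the neighbourhood Γ(α).  As G is arc-transitive and
-- normalises N, all N_α-orbits on Γ(α) (the suborbits) have one size s, so
-- s divides 2r and s ≤ 2, s = r or s = 2r.
--   s ≤ 2:  growing a set F ∋ α along edges (Γ is connected), each new vertex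
--           has at most two images under N_(F), so every pointwise stabiliser
--           N_(F), in particular N_α, has order a power of 2.
--   s = 2r: N_α is transitive on Γ(α), so N is arc-transitive.
--   s = r:  the arcs form two N-orbits, through (α , β₀) and (α , β₁).  If the
--           first is not self-paired, the second consists of the reversed
--           arcs and N is edge-transitive; otherwise the two orbits give the
--           splitting, interchanged by g ∈ G with (α , β₀)g = (α , β₁).

open import Defs

open import Data.Bool.Base using (Bool; true; false; not; _∧_)
import Data.Bool.Properties as Bool
open import Data.Empty using (⊥; ⊥-elim)
open import Data.Fin.Base using (Fin)
open import Data.Fin.Permutation using (_⟨$⟩ʳ_; _≈_; flip; _∘ₚ_; inverseˡ; inverseʳ) renaming (id to identity)
open import Data.Fin.Properties using (_≟_; all?; ¬∀⟶∃¬) renaming (any? to ∃?)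
open import Data.List.Base using (List; []; _∷_; length; filter; map; allFin)
open import Data.List.Fresh as List# using (fromList)
import Data.List.Fresh.Membership.Setoid.Properties as Fresh
import Data.List.Fresh.Relation.Unary.Any as Any#
open import Data.List.Membership.Propositional using (_∈_; _∉_; find)
open import Data.List.Membership.Propositional.Properties using (∈-filter⁺; ∈-filter⁻; ∈-allFin; ∈-map⁻)
open import Data.List.Properties using (length-map; filter-some; filter-none)
open import Data.List.Relation.Unary.All using (All; []; _∷_)
import Data.List.Relation.Unary.All as All
open import Data.List.Relation.Unary.All.Properties using (¬Any⇒All¬)
open import Data.List.Relation.Unary.AllPairs using (AllPairs; []; _∷_)
import Data.List.Relation.Unary.AllPairs as AllPairs
import Data.List.Relation.Unary.AllPairs.Properties as AllPairs
open import Data.List.Relation.Unary.Any using (Any; here; there; any?)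
import Data.List.Relation.Unary.Any as Any
open import Data.List.Relation.Unary.Unique.Propositional.Properties using (allFin⁺; filter⁺)
open import Data.Nat.Base
open import Data.Nat.Divisibility using (_∣_; divides; ∣⇒≤; _∣0; ∣-refl; ∣m∣n⇒∣m+n)
open import Data.Nat.Primality using (Prime; euclidsLemma; prime⇒nonZero)
open import Data.Nat.Properties
  using (+-suc; +-identityʳ; +-monoʳ-<; +-cancelˡ-≡; *-comm; *-assoc; *-identityˡ; *-zeroʳ; *-mono-≤; *-monoˡ-<;
         *-cancelʳ-≡; m≤n*m; _≤?_; ≰⇒>; ≤-pred; ≤-refl; ≤-reflexive; ≤-antisym; ≤-trans; <⇒≢; <⇒≱;
         module ≤-Reasoning)
open import Data.Product.Base using (∃; _×_; _,_; proj₁; proj₂; swap)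
open import Data.Sum.Base using (_⊎_; inj₁; inj₂)
import Data.Sum.Base as Sum
open import Function.Base using (id)
open import Function.Bundles using (mk⇔)
open import Relation.Binary.Bundles using (Setoid)
open import Relation.Binary.Construct.Closure.ReflexiveTransitive using (Star; ε; _◅_)
open import Relation.Binary.PropositionalEquality
  using (_≡_; _≢_; refl; sym; trans; cong; cong₂; subst; subst₂; setoid; ≢-sym; module ≡-Reasoning)
open import Relation.Nullary using (¬_; Dec; does; yes; no; _×-dec_; ¬?)
open import Relation.Nullary.Decidable using (dec-true; dec-false; does-⇔)
open import Relation.Unary using (Pred; Decidable)
open import Relation.Unary.Properties using (_∩?_; ∁?)

module _ {a} {A : Set a} where

  count : ∀ {p} {P : Pred A p} → Decidable P → List A → ℕ
  count P? xs = length (filter P? xs)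

  count-cong : ∀ {p q} {P : Pred A p} {Q : Pred A q} (P? : Decidable P) (Q? : Decidable Q) xs →
    (∀ {x} → x ∈ xs → (P x → Q x) × (Q x → P x)) → count P? xs ≡ count Q? xs
  count-cong P? Q? []       P⇔Q = refl
  count-cong P? Q? (x ∷ xs) P⇔Q with P? x | Q? x
  ... | yes _  | yes _  = cong suc (count-cong P? Q? xs (λ x∈ → P⇔Q (there x∈)))
  ... | no  _  | no  _  = count-cong P? Q? xs (λ x∈ → P⇔Q (there x∈))
  ... | yes px | no ¬qx = ⊥-elim (¬qx (proj₁ (P⇔Q (here refl)) px))
  ... | no ¬px | yes qx = ⊥-elim (¬px (proj₂ (P⇔Q (here refl)) qx))

  count-split : ∀ {p q} {P : Pred A p} {Q : Pred A q} (P? : Decidable P) (Q? : Decidable Q) xs →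
    count P? xs ≡ count (P? ∩? Q?) xs + count (P? ∩? ∁? Q?) xs
  count-split P? Q? []       = refl
  count-split P? Q? (x ∷ xs) with P? x | Q? x
  ... | yes _ | yes _ = cong suc (count-split P? Q? xs)
  ... | yes _ | no  _ = trans (cong suc (count-split P? Q? xs)) (sym (+-suc _ _))
  ... | no  _ | _     = count-split P? Q? xs

  count-witness : ∀ {p} {P : Pred A p} (P? : Decidable P) xs → 0 < count P? xs → ∃ λ x → x ∈ xs × P x
  count-witness P? xs pos with filter P? xs in eq
  ... | x ∷ _ = x , ∈-filter⁻ P? (subst (x ∈_) (sym eq) (here refl))

  count-< : ∀ {p q} {P : Pred A p} {Q : Pred A q} (P? : Decidable P) (Q? : Decidable Q) xs →
    (∀ {x} → x ∈ xs → P x → Q x) → ∀ {b} → b ∈ xs → Q b → ¬ P b → count P? xs < count Q? xs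
  count-< P? Q? xs P⊆Q {b} b∈ qb ¬pb = begin-strict
    count P? xs                                          ≡⟨ sym (+-identityʳ _) ⟩
    count P? xs + 0                                      <⟨ +-monoʳ-< (count P? xs) outside ⟩
    count P? xs + count (Q? ∩? ∁? P?) xs                 ≡⟨ cong (_+ count (Q? ∩? ∁? P?) xs) (sym inside) ⟩
    count (Q? ∩? P?) xs + count (Q? ∩? ∁? P?) xs         ≡⟨ sym (count-split Q? P? xs) ⟩
    count Q? xs                                          ∎
    where
    open ≤-Reasoning
    inside : count (Q? ∩? P?) xs ≡ count P? xs
    inside = count-cong (Q? ∩? P?) P? xs λ x∈ → proj₂ , λ px → P⊆Q x∈ px , px
    outside : 0 < count (Q? ∩? ∁? P?) xs
    outside = filter-some (Q? ∩? ∁? P?) (Any.map (λ { refl → qb , ¬pb }) b∈)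

module Injection {c ℓ} (S : Setoid c ℓ) where
  open Setoid S using () renaming (Carrier to A; _≈_ to _∼_; _≉_ to _≁_; sym to ∼-sym)
  open import Data.List.Membership.Setoid S using () renaming (_∈_ to _∈ₛ_)
  open import Data.List.Membership.Setoid.Properties using (∈-resp-≈)

  private
    fromList-length : ∀ {xs} (u : AllPairs _≁_ xs) → List#.length (fromList u) ≡ length xs
    fromList-length []      = refl
    fromList-length (_ ∷ u) = cong suc (fromList-length u)

    fromList-Any⁺ : ∀ {p} {P : Pred A p} {xs} (u : AllPairs _≁_ xs) → Any P xs → Any#.Any P (fromList u)
    fromList-Any⁺ (_ ∷ u) (here p)  = Any#.here p
    fromList-Any⁺ (_ ∷ u) (there p) = Any#.there (fromList-Any⁺ u p)

    fromList-Any⁻ : ∀ {p} {P : Pred A p} {xs} (u : AllPairs _≁_ xs) → Any#.Any P (fromList u) → Any P xs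
    fromList-Any⁻ (_ ∷ u) (Any#.here p)  = here p
    fromList-Any⁻ (_ ∷ u) (Any#.there p) = there (fromList-Any⁻ u p)

  distinct-length-≤ : ∀ {xs ys} → AllPairs _≁_ xs → AllPairs _≁_ ys →
    (∀ {x} → x ∈ xs → x ∈ₛ ys) → length xs ≤ length ys
  distinct-length-≤ {xs} {ys} uxs uys xs⊆ys =
    subst₂ _≤_ (fromList-length uxs) (fromList-length uys) (Fresh.injection S id embed)
    where
    embed : ∀ {x} → Any#.Any (x ∼_) (fromList uxs) → Any#.Any (x ∼_) (fromList uys)
    embed x∈ with find (fromList-Any⁻ uxs x∈)
    ... | x′ , x′∈xs , x∼x′ = fromList-Any⁺ uys (∈-resp-≈ S (∼-sym x∼x′) (xs⊆ys x′∈xs))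

  count-injection : ∀ {p q} {P : Pred A p} {Q : Pred A q} (P? : Decidable P) (Q? : Decidable Q) xs →
    AllPairs _≁_ xs → (f : A → A) → (∀ {x y} → f x ∼ f y → x ∼ y) →
    (∀ {x} → x ∈ xs → P x → ∃ λ y → y ∈ xs × Q y × f x ∼ y) → count P? xs ≤ count Q? xs
  count-injection P? Q? xs uxs f f-inj f-maps =
    subst (_≤ count Q? xs) (length-map f (filter P? xs))
      (distinct-length-≤ (AllPairs.map⁺ (AllPairs.map (λ x≁y fx∼fy → x≁y (f-inj fx∼fy)) (AllPairs.filter⁺ P? uxs)))
                         (AllPairs.filter⁺ Q? uxs) image)
    where
    image : ∀ {z} → z ∈ map f (filter P? xs) → z ∈ₛ filter Q? xs
    image z∈ with ∈-map⁻ f z∈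
    ... | x , x∈ , refl with f-maps (proj₁ (∈-filter⁻ P? {xs = xs} x∈)) (proj₂ (∈-filter⁻ P? {xs = xs} x∈))
    ...   | y , y∈xs , qy , fx∼y = Any.map (λ { refl → fx∼y }) (∈-filter⁺ Q? y∈xs qy)

module _ {n : ℕ} where
  open Injection (setoid (Fin n)) using (distinct-length-≤; count-injection)

  card : ∀ {p} {P : Pred (Fin n) p} → Decidable P → ℕ
  card P? = count P? (allFin n)

  card-positive : ∀ {p} {P : Pred (Fin n) p} (P? : Decidable P) {x} → P x → 0 < card P?
  card-positive P? {x} px = filter-some P? (Any.map (λ { refl → px }) (∈-allFin x))

  card-witness : ∀ {p} {P : Pred (Fin n) p} (P? : Decidable P) → 0 < card P? → ∃ P
  card-witness P? pos with count-witness P? (allFin n) pos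
  ... | x , _ , px = x , px

  card-empty : ∀ {p} {P : Pred (Fin n) p} (P? : Decidable P) → (∀ x → ¬ P x) → card P? ≡ 0
  card-empty P? ∄P = cong length (filter-none P? {xs = allFin n} (All.tabulate λ {x} _ → ∄P x))

  card-≡⇒⊇ : ∀ {p q} {P : Pred (Fin n) p} {Q : Pred (Fin n) q} (P? : Decidable P) (Q? : Decidable Q) →
    (∀ {x} → P x → Q x) → card P? ≡ card Q? → ∀ {x} → Q x → P x
  card-≡⇒⊇ P? Q? P⊆Q eq {x} qx with P? x
  ... | yes px = px
  ... | no ¬px = ⊥-elim (<⇒≢ (count-< P? Q? (allFin n) (λ _ → P⊆Q) (∈-allFin x) qx ¬px) eq)

  card-bijection : ∀ {p q} {P : Pred (Fin n) p} {Q : Pred (Fin n) q} (P? : Decidable P) (Q? : Decidable Q)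
    (f g : Fin n → Fin n) → (∀ x → g (f x) ≡ x) → (∀ x → f (g x) ≡ x) →
    (∀ x → P x → Q (f x)) → (∀ x → Q (f x) → P x) → card P? ≡ card Q?
  card-bijection {Q = Q} P? Q? f g gf fg P⇒Qf Qf⇒P = ≤-antisym
    (count-injection P? Q? (allFin n) (allFin⁺ n) f (injective f g gf)
       λ {x} _ px → f x , ∈-allFin (f x) , P⇒Qf x px , refl)
    (count-injection Q? P? (allFin n) (allFin⁺ n) g (injective g f fg)
       λ {x} _ qx → g x , ∈-allFin (g x) , Qf⇒P (g x) (subst Q (sym (fg x)) qx) , refl)
    where
    injective : (h k : Fin n → Fin n) → (∀ x → k (h x) ≡ x) → ∀ {x y} → h x ≡ h y → x ≡ y
    injective h k kh {x} {y} hx≡hy = trans (sym (kh x)) (trans (cong k hx≡hy) (kh y))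

  card≤2⇒pair : ∀ {p} {P : Pred (Fin n) p} (P? : Decidable P) → card P? ≤ 2 →
    ∀ {a} → P a → ∃ λ b → ∀ {x} → P x → x ≡ a ⊎ x ≡ b
  card≤2⇒pair {P = P} P? card≤2 {a} pa with ∃? (λ y → P? y ×-dec ¬? (y ≟ a))
  ... | no ∄b = a , only-a
    where
    only-a : ∀ {x} → P x → x ≡ a ⊎ x ≡ a
    only-a {x} px with x ≟ a
    ... | yes x≡a = inj₁ x≡a
    ... | no x≢a = ⊥-elim (∄b (x , px , x≢a))
  ... | yes (b , pb , b≢a) = b , a-or-b
    where
    a-or-b : ∀ {x} → P x → x ≡ a ⊎ x ≡ b
    a-or-b {x} px with x ≟ a | x ≟ b
    ... | yes x≡a | _       = inj₁ x≡a
    ... | no _    | yes x≡b = inj₂ x≡b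
    ... | no x≢a  | no x≢b  = ⊥-elim (<⇒≱ (s≤s (s≤s (s≤s z≤n))) (≤-trans three card≤2))
      where
      member : ∀ {y} → P y → y ∈ filter P? (allFin n)
      member py = ∈-filter⁺ P? (∈-allFin _) py
      three : 3 ≤ card P?
      three = distinct-length-≤ ((≢-sym b≢a ∷ ≢-sym x≢a ∷ []) ∷ (≢-sym x≢b ∷ []) ∷ [] ∷ [])
                (filter⁺ P? (allFin⁺ n))
                λ { (here refl) → member pa ; (there (here refl)) → member pb ; (there (there (here refl))) → member px }

p>0 : ∀ {r} → Prime r → 0 < r
p>0 {r} pr = >-nonZero⁻¹ r {{prime⇒nonZero pr}}

2p>0 : ∀ {r} → Prime r → 0 < 2 * r
2p>0 {r} pr = ≤-trans (p>0 pr) (m≤n*m r 2)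

large-divisor-of-2p : ∀ {r s} → Prime r → s ∣ 2 * r → 3 ≤ s → s ≡ r ⊎ s ≡ 2 * r
large-divisor-of-2p {r} {s} pr (divides zero 2r≡0) _ = ⊥-elim (<⇒≢ (2p>0 pr) (sym 2r≡0))
large-divisor-of-2p {r} {s} pr (divides t@(suc _) 2r≡ts) 3≤s with euclidsLemma t s pr (divides 2 (sym 2r≡ts))
... | inj₁ r∣t = ⊥-elim (<⇒≱ 2r<ts (≤-reflexive (sym 2r≡ts)))
  where
  2r<ts : 2 * r < t * s
  2r<ts = begin-strict
    2 * r <⟨ *-monoˡ-< r {{prime⇒nonZero pr}} {2} {3} ≤-refl ⟩
    3 * r ≡⟨ *-comm 3 r ⟩
    r * 3 ≤⟨ *-mono-≤ (∣⇒≤ r∣t) 3≤s ⟩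
    t * s ∎
    where open ≤-Reasoning
... | inj₂ (divides v refl) = v≡1∨2 v tv≡2
  where
  instance _ = prime⇒nonZero pr
  tv≡2 : 2 ≡ t * v
  tv≡2 = *-cancelʳ-≡ 2 (t * v) r (trans 2r≡ts (sym (*-assoc t v r)))
  v≡1∨2 : ∀ v → 2 ≡ t * v → v * r ≡ r ⊎ v * r ≡ 2 * r
  v≡1∨2 0 2≡t*0 = ⊥-elim (<⇒≢ (s≤s z≤n) (sym (trans 2≡t*0 (*-zeroʳ t))))
  v≡1∨2 1 _ = inj₁ (*-identityˡ r)
  v≡1∨2 2 _ = inj₂ refl
  v≡1∨2 (suc (suc (suc w))) 2≡t*v =
    ⊥-elim (<⇒≱ (≤-trans (s≤s (s≤s (s≤s z≤n))) (m≤n*m (3 + w) t)) (≤-reflexive (sym 2≡t*v)))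


PermSetoid : ℕ → Setoid _ _
PermSetoid n = record
  { Carrier       = Perm n
  ; _≈_           = _≈_
  ; isEquivalence = record { refl = λ _ → refl ; sym = λ e x → sym (e x) ; trans = λ e f x → trans (e x) (f x) }
  }

∧-true : ∀ {a b} → a ∧ b ≡ true → a ≡ true × b ≡ true
∧-true {true} {true} _ = refl , refl

_∈?_ : ∀ {n} (x : Fin n) (F : List (Fin n)) → Dec (x ∈ F)
x ∈? F = any? (x ≟_) F

boundary-edge : ∀ {n} (adj : Adj n) {F a x} → Star (Edge' adj) a x → a ∈ F → x ∉ F →
  ∃ λ v → ∃ λ w → v ∈ F × w ∉ F × adj v w ≡ true
boundary-edge adj ε a∈F a∉F = ⊥-elim (a∉F a∈F)
boundary-edge adj {F} (_◅_ {j = y} a~y path) a∈F x∉F with y ∈? F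
... | yes y∈F = boundary-edge adj path y∈F x∉F
... | no y∉F = _ , y , a∈F , y∉F , a~y

∈⇒∈ₚ : ∀ {n} {h : Perm n} {hs} → h ∈ hs → h ∈ₚ hs
∈⇒∈ₚ = Any.map (λ { refl _ → refl })

inverse-maps-back : ∀ {n} (g : Perm n) {x y} → g ⟨$⟩ʳ x ≡ y → flip g ⟨$⟩ʳ y ≡ x
inverse-maps-back g refl = inverseˡ g

module Orbitals {n : ℕ} (adj : Adj n) (G N : List (Perm n))
                (autG : AutGroup adj G) (normal : IsNormalSubgroup N G) where

  module N⊴G = IsNormalSubgroup normal
  module N = IsPermGroup N⊴G.group
  module G = IsPermGroup (proj₁ autG)

  automorphism-of-N : ∀ {h} → h ∈ₚ N → IsAutomorphism adj h
  automorphism-of-N {h} h∈N = proj₂ autG {h} (N⊴G.subset {h} h∈N)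

  Orbital : Fin n → Fin n → Fin n → Fin n → Set
  Orbital a b u v = Any (λ h → h ⟨$⟩ʳ a ≡ u × h ⟨$⟩ʳ b ≡ v) N

  orbital? : ∀ a b u v → Dec (Orbital a b u v)
  orbital? a b u v = any? (λ h → (h ⟨$⟩ʳ a ≟ u) ×-dec (h ⟨$⟩ʳ b ≟ v)) N

  orbital-intro : ∀ h {a b u v} → h ∈ₚ N → h ⟨$⟩ʳ a ≡ u → h ⟨$⟩ʳ b ≡ v → Orbital a b u v
  orbital-intro h {a} {b} h∈N ha≡u hb≡v = Any.map (λ k≈h → trans (k≈h a) ha≡u , trans (k≈h b) hb≡v) h∈N

  orbital-elim : ∀ {a b u v} → Orbital a b u v → ∃ λ h → h ∈ₚ N × h ⟨$⟩ʳ a ≡ u × h ⟨$⟩ʳ b ≡ v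
  orbital-elim o with find o
  ... | h , h∈N , maps = h , ∈⇒∈ₚ h∈N , maps

  orbital-refl : ∀ {a b} → Orbital a b a b
  orbital-refl {a} {b} = Any.map (λ h≈id → h≈id a , h≈id b) N.has-id

  orbital-trans : ∀ {a b c d u v} → Orbital a b c d → Orbital c d u v → Orbital a b u v
  orbital-trans o₁ o₂ with orbital-elim o₁ | orbital-elim o₂
  ... | h₁ , h₁∈N , refl , refl | h₂ , h₂∈N , refl , refl =
    orbital-intro (h₁ ∘ₚ h₂) (N.closed-∘ {h₁} {h₂} h₁∈N h₂∈N) refl refl

  orbital-sym : ∀ {a b c d} → Orbital a b c d → Orbital c d a b
  orbital-sym o with orbital-elim o
  ... | h , h∈N , ha≡c , hb≡d = orbital-intro (flip h) (N.closed-⁻¹ {h} h∈N) (inverse-maps-back h ha≡c) (inverse-maps-back h hb≡d)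

  orbital-swap : ∀ {a b u v} → Orbital a b u v → Orbital b a v u
  orbital-swap = Any.map swap

  orbital-relate : ∀ {a b u v x y} → Orbital a b u v → Orbital a b x y →
    ∃ λ h → h ∈ₚ N × h ⟨$⟩ʳ u ≡ x × h ⟨$⟩ʳ v ≡ y
  orbital-relate o₁ o₂ = orbital-elim (orbital-trans (orbital-sym o₁) o₂)

  orbital-conj : ∀ {g a b u v} → g ∈ₚ G → Orbital a b u v → Orbital (g ⟨$⟩ʳ a) (g ⟨$⟩ʳ b) (g ⟨$⟩ʳ u) (g ⟨$⟩ʳ v)
  orbital-conj {g} g∈G o with orbital-elim o
  ... | h , h∈N , refl , refl = orbital-intro (flip g ∘ₚ h ∘ₚ g) (N⊴G.conjugate {g} {h} g∈G h∈N)
          (cong (λ x → g ⟨$⟩ʳ (h ⟨$⟩ʳ x)) (inverseˡ g)) (cong (λ x → g ⟨$⟩ʳ (h ⟨$⟩ʳ x)) (inverseˡ g))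

  orbital-conj⁻¹ : ∀ {g a b u v} → g ∈ₚ G → Orbital (g ⟨$⟩ʳ a) (g ⟨$⟩ʳ b) (g ⟨$⟩ʳ u) (g ⟨$⟩ʳ v) → Orbital a b u v
  orbital-conj⁻¹ {g} {u = u} {v} g∈G o =
    subst₂ (λ a b → Orbital a b u v) (inverseˡ g) (inverseˡ g)
      (subst₂ (Orbital _ _) (inverseˡ g) (inverseˡ g) (orbital-conj {flip g} (G.closed-⁻¹ {g} g∈G) o))

  orbital-adj : ∀ {a b u v} → Orbital a b u v → adj u v ≡ adj a b
  orbital-adj o with orbital-elim o
  ... | h , h∈N , refl , refl = automorphism-of-N {h} h∈N _ _

module Suborbits {n : ℕ} (adj : Adj n) (r : ℕ) (G N : List (Perm n)) (α : Fin n)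
                 (pr : Prime r) (reg : Regular adj (2 * r)) (autG : AutGroup adj G)
                 (atG : ArcTransitive adj G) (normal : IsNormalSubgroup N G) where

  open Orbitals adj G N autG normal public

  Neighbour : Fin n → Set
  Neighbour x = adj α x ≡ true

  neighbour? : Decidable Neighbour
  neighbour? x = adj α x Bool.≟ true

  -- a fixed neighbour β₀ of α (opaque: only its defining property is used,
  -- and unfolding the search that finds it makes type-checking very slow)
  opaque
    β₀ : Fin n
    β₀ = proj₁ (card-witness neighbour? (subst (0 <_) (sym (reg α)) (2p>0 pr)))

    β₀-neighbour : Neighbour β₀
    β₀-neighbour = proj₂ (card-witness neighbour? (subst (0 <_) (sym (reg α)) (2p>0 pr)))

  -- the N_v-orbit of w: the points x with (v , x) in the orbital of (v , w)
  Suborbit : Fin n → Fin n → Fin n → Set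
  Suborbit v w x = Orbital v w v x

  suborbit? : ∀ v w → Decidable (Suborbit v w)
  suborbit? v w = orbital? v w v

  s : ℕ
  s = card (suborbit? α β₀)

  -- the suborbits at all arcs have the same size, since G is arc-transitive
  suborbit-size : ∀ {v w} → adj v w ≡ true → card (suborbit? v w) ≡ s
  suborbit-size e with atG α β₀ _ _ β₀-neighbour e
  ... | g , g∈G , refl , refl = sym (card-bijection (suborbit? α β₀) (suborbit? _ _)
          (g ⟨$⟩ʳ_) (flip g ⟨$⟩ʳ_) (λ _ → inverseˡ g) (λ _ → inverseʳ g)
          (λ _ → orbital-conj {g} g∈G) (λ _ → orbital-conj⁻¹ {g} g∈G))

  suborbit-neighbour : ∀ {β x} → Neighbour β → Suborbit α β x → Neighbour x
  suborbit-neighbour β~α o = trans (orbital-adj o) β~α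

  union-of-suborbits : ∀ k {p} {S : Pred (Fin n) p} (S? : Decidable S) → card S? ≤ k →
    (∀ {x} → S x → Neighbour x) → (∀ {x y} → S x → Suborbit α x y → S y) → s ∣ card S?
  union-of-suborbits k S? size≤k S⊆Γ closed with ∃? S?
  ... | no ∄S = subst (s ∣_) (sym (card-empty S? λ x Sx → ∄S (x , Sx))) (s ∣0)
  union-of-suborbits zero S? size≤0 S⊆Γ closed | yes (β , Sβ) = ⊥-elim (<⇒≱ (card-positive S? Sβ) size≤0)
  union-of-suborbits (suc k) {S = S} S? size≤k S⊆Γ closed | yes (β , Sβ) =
    subst (s ∣_) (sym split) (∣m∣n⇒∣m+n ∣-refl (union-of-suborbits k rest? rest≤k (λ (Sx , _) → S⊆Γ Sx) rest-closed))
    where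
    Rest : Pred (Fin n) _
    Rest x = S x × ¬ Suborbit α β x

    rest? : Decidable Rest
    rest? = S? ∩? ∁? (suborbit? α β)

    split : card S? ≡ s + card rest?
    split = begin
      card S?                                        ≡⟨ count-split S? (suborbit? α β) (allFin n) ⟩
      card (S? ∩? suborbit? α β) + card rest?        ≡⟨ cong (_+ card rest?) suborbit-of-β ⟩
      s + card rest?                                 ∎
      where
      open ≡-Reasoning
      suborbit-of-β : card (S? ∩? suborbit? α β) ≡ s
      suborbit-of-β = trans (count-cong (S? ∩? suborbit? α β) (suborbit? α β) (allFin n) λ _ → proj₂ , λ o → closed Sβ o , o)
                            (suborbit-size (S⊆Γ Sβ))

    rest≤k : card rest? ≤ k
    rest≤k = ≤-pred (≤-trans (count-< rest? S? (allFin n) (λ _ → proj₁) (∈-allFin β) Sβ (λ (_ , ¬o) → ¬o orbital-refl)) size≤k)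

    rest-closed : ∀ {x y} → Rest x → Suborbit α x y → Rest y
    rest-closed (Sx , ¬o) o = closed Sx o , λ o′ → ¬o (orbital-trans o′ (orbital-sym o))

  -- Γ(α) itself is a union of suborbits
  s∣2r : s ∣ 2 * r
  s∣2r = subst (s ∣_) (reg α) (union-of-suborbits (card neighbour?) neighbour? ≤-refl id suborbit-neighbour)

  -- For a list F of vertices containing α,
  -- the pointwise stabiliser N_(F) has order a power of 2, by induction on
  -- the number of vertices outside F: by connectivity some edge v ~ w leaves
  -- F, N_(F) ≤ N_v moves w inside a set of at most two points, so
  -- |N_(F) : N_(w ∷ F)| ≤ 2.
  module TwoGroupCase (connected : Connected adj) (s≤2 : s ≤ 2) where

    open Injection (PermSetoid n) using (distinct-length-≤; count-injection)

    two-images : ∀ {v w} → adj v w ≡ true →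
      ∃ λ w′ → ∀ {h} → h ∈ₚ N → h ⟨$⟩ʳ v ≡ v → h ⟨$⟩ʳ w ≡ w ⊎ h ⟨$⟩ʳ w ≡ w′
    two-images v~w with card≤2⇒pair (suborbit? _ _) (≤-trans (≤-reflexive (suborbit-size v~w)) s≤2) orbital-refl
    ... | w′ , pair = w′ , λ {h} h∈N hv≡v → pair (orbital-intro h h∈N hv≡v refl)

    Fixes : List (Fin n) → Perm n → Set
    Fixes F h = All (λ x → h ⟨$⟩ʳ x ≡ x) F

    fixes? : ∀ F → Decidable (Fixes F)
    fixes? F h = All.all? (λ x → h ⟨$⟩ʳ x ≟ x) F

    Stab : List (Fin n) → List (Perm n)
    Stab F = filter (fixes? F) N

    stabiliser-of-everything : ∀ {F} → (∀ x → x ∈ F) → length (Stab F) ≡ 1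
    stabiliser-of-everything {F} everything = ≤-antisym at-most-one at-least-one
      where
      fixes-everything : ∀ {h} → Fixes F h → ∀ x → h ⟨$⟩ʳ x ≡ x
      fixes-everything fixesF x = All.lookup fixesF (everything x)
      at-most-one : length (Stab F) ≤ 1
      at-most-one = distinct-length-≤ {ys = identity ∷ []} (AllPairs.filter⁺ (fixes? F) N.distinct) ([] ∷ [])
        λ {h} h∈ → here (fixes-everything {h} (proj₂ (∈-filter⁻ (fixes? F) {xs = N} h∈)))
      at-least-one : 1 ≤ length (Stab F)
      at-least-one = filter-some (fixes? F) (Any.map (λ h≈id → All.tabulate λ {x} _ → h≈id x) N.has-id)

    translate-≤ : ∀ {p q} {P : Pred (Perm n) p} {Q : Pred (Perm n) q} (P? : Decidable P) (Q? : Decidable Q) t →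
      t ∈ₚ N → (∀ {k} → k ∈ N → P k → Q (k ∘ₚ t)) → (∀ {k m} → k ≈ m → Q k → Q m) → count P? N ≤ count Q? N
    translate-≤ P? Q? t t∈N P⇒Q Q-resp = count-injection P? Q? N N.distinct (_∘ₚ t)
      (λ {k} {m} kt≈mt x → trans (sym (inverseˡ t)) (trans (cong (flip t ⟨$⟩ʳ_) (kt≈mt x)) (inverseˡ t)))
      λ {k} k∈N pk → let (m , m∈N , m≈kt) = find (N.closed-∘ {k} {t} (∈⇒∈ₚ k∈N) t∈N)
                     in m , m∈N , Q-resp (λ x → sym (m≈kt x)) (P⇒Q k∈N pk) , λ x → sym (m≈kt x)

    fixes-resp : ∀ {F k m} → k ≈ m → Fixes F k → Fixes F m
    fixes-resp k≈m = All.map (λ {x} kx≡x → trans (sym (k≈m x)) kx≡x)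

    fixes-point? : ∀ w → Decidable (λ (h : Perm n) → h ⟨$⟩ʳ w ≡ w)
    fixes-point? w h = h ⟨$⟩ʳ w ≟ w

    Moves : List (Fin n) → Fin n → Perm n → Set
    Moves F w h = Fixes F h × h ⟨$⟩ʳ w ≢ w

    moves? : ∀ F w → Decidable (Moves F w)
    moves? F w = fixes? F ∩? ∁? (fixes-point? w)

    stabiliser-split : ∀ F w → length (Stab F) ≡ length (Stab (w ∷ F)) + count (moves? F w) N
    stabiliser-split F w = trans (count-split (fixes? F) (fixes-point? w) N)
      (cong (_+ count (moves? F w) N) (count-cong (fixes? F ∩? fixes-point? w) (fixes? (w ∷ F)) N
        λ _ → (λ (fixesF , hw≡w) → hw≡w ∷ fixesF) , λ { (hw≡w ∷ fixesF) → fixesF , hw≡w }))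

    -- if h₀ ∈ N_(F) moves w, where v ~ w for some v ∈ F, then h₀ w = w′ is the only
    -- other image of w, so the elements moving w form the coset N_(w ∷ F) h₀
    moving-coset : ∀ {F v w} → v ∈ F → adj v w ≡ true → ∀ {h₀} → h₀ ∈ N → Moves F w h₀ →
      count (moves? F w) N ≡ length (Stab (w ∷ F))
    moving-coset {F} {v} {w} v∈F v~w {h₀} h₀∈N (fixes₀ , h₀w≢w) = ≤-antisym
      (translate-≤ (moves? F w) (fixes? (w ∷ F)) (flip h₀) (N.closed-⁻¹ {h₀} (∈⇒∈ₚ h₀∈N))
         (λ {k} k∈N → undo {k} k∈N) (λ {k} {m} → fixes-resp {w ∷ F} {k} {m}))
      (translate-≤ (fixes? (w ∷ F)) (moves? F w) h₀ (∈⇒∈ₚ h₀∈N) (λ {k} _ → redo {k}) (λ {k} {m} → moves-resp {k} {m}))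
      where
      w′ : Fin n
      w′ = proj₁ (two-images v~w)

      image : ∀ {h} → h ∈ₚ N → Moves F w h → h ⟨$⟩ʳ w ≡ w′
      image {h} h∈N (fixesF , hw≢w) with proj₂ (two-images v~w) {h} h∈N (All.lookup fixesF v∈F)
      ... | inj₁ hw≡w  = ⊥-elim (hw≢w hw≡w)
      ... | inj₂ hw≡w′ = hw≡w′

      moves-resp : ∀ {k m} → k ≈ m → Moves F w k → Moves F w m
      moves-resp {k} {m} k≈m (fixesF , kw≢w) = fixes-resp {F} {k} {m} k≈m fixesF , λ mw≡w → kw≢w (trans (k≈m w) mw≡w)

      -- k ↦ k h₀ maps N_(w ∷ F) into the elements moving w ...
      redo : ∀ {k} → Fixes (w ∷ F) k → Moves F w (k ∘ₚ h₀)
      redo (kw≡w ∷ fixesF) = All.zipWith (λ (kx≡x , h₀x≡x) → trans (cong (h₀ ⟨$⟩ʳ_) kx≡x) h₀x≡x) (fixesF , fixes₀)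
                           , λ e → h₀w≢w (trans (sym (cong (h₀ ⟨$⟩ʳ_) kw≡w)) e)

      -- ... and k ↦ k h₀⁻¹ maps them back, since they all send w to w′ = h₀ w
      undo : ∀ {k} → k ∈ N → Moves F w k → Fixes (w ∷ F) (k ∘ₚ flip h₀)
      undo {k} k∈N (fixesF , kw≢w) =
        inverse-maps-back h₀ (trans (image {h₀} (∈⇒∈ₚ h₀∈N) (fixes₀ , h₀w≢w))
                                    (sym (image {k} (∈⇒∈ₚ k∈N) (fixesF , kw≢w))))
        ∷ All.zipWith (λ (kx≡x , h₀x≡x) → trans (cong (flip h₀ ⟨$⟩ʳ_) kx≡x) (inverse-maps-back h₀ h₀x≡x))
                      (fixesF , fixes₀)

    -- orbit–stabiliser: N_(F) acts on w ∈ {w, w′}, so |N_(F) : N_(w ∷ F)| ∈ {1, 2}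
    stabiliser-step : ∀ {F v w} → v ∈ F → adj v w ≡ true →
      length (Stab F) ≡ length (Stab (w ∷ F)) ⊎ length (Stab F) ≡ 2 * length (Stab (w ∷ F))
    stabiliser-step {F} {v} {w} v∈F v~w with any? (moves? F w) N
    ... | no none = inj₁ (trans (stabiliser-split F w) (trans (cong (length (Stab (w ∷ F)) +_) nothing-moves) (+-identityʳ _)))
      where
      nothing-moves : count (moves? F w) N ≡ 0
      nothing-moves = cong length (filter-none (moves? F w) (¬Any⇒All¬ N none))
    ... | yes some with find some
    ...   | h₀ , h₀∈N , moves₀ = inj₂ (trans (stabiliser-split F w)
              (cong (length (Stab (w ∷ F)) +_) (trans (moving-coset v∈F v~w h₀∈N moves₀) (sym (+-identityʳ _)))))

    outside : List (Fin n) → ℕ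
    outside F = card (∁? (_∈? F))

    outside-positive : ∀ {F x} → x ∉ F → 0 < outside F
    outside-positive {F} x∉F = card-positive (∁? (_∈? F)) x∉F

    outside-decreases : ∀ {F w} → w ∉ F → outside (w ∷ F) < outside F
    outside-decreases {F} {w} w∉F = count-< (∁? (_∈? (w ∷ F))) (∁? (_∈? F)) (allFin n)
      (λ _ x∉wF x∈F → x∉wF (there x∈F)) (∈-allFin w) w∉F (λ w∉wF → w∉wF (here refl))

    stabiliser-2-power : ∀ k F → outside F ≤ k → α ∈ F → ∃ λ j → length (Stab F) ≡ 2 ^ j

    across : ∀ k F → outside F ≤ k → α ∈ F → (∃ λ v → ∃ λ w → v ∈ F × w ∉ F × adj v w ≡ true) →
      ∃ λ j → length (Stab F) ≡ 2 ^ j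
    across zero    F outside≤0 α∈F (v , w , v∈F , w∉F , v~w) = ⊥-elim (<⇒≱ (outside-positive w∉F) outside≤0)
    across (suc k) F outside≤k α∈F (v , w , v∈F , w∉F , v~w)
      with stabiliser-2-power k (w ∷ F) (≤-pred (≤-trans (outside-decreases w∉F) outside≤k)) (there α∈F)
         | stabiliser-step {F} v∈F v~w
    ... | j , |Stab|≡2^j | inj₁ same   = j , trans same |Stab|≡2^j
    ... | j , |Stab|≡2^j | inj₂ double = suc j , trans double (cong (2 *_) |Stab|≡2^j)

    stabiliser-2-power k F outside≤k α∈F with all? (_∈? F)
    ... | yes everything = 0 , stabiliser-of-everything everything
    ... | no ¬everything with ¬∀⟶∃¬ n (_∈ F) (_∈? F) ¬everything
    ...   | x , x∉F = across k F outside≤k α∈F (boundary-edge adj (connected α x) α∈F x∉F)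

    two-group : Is2Group (stabiliser N α)
    two-group with stabiliser-2-power (outside (α ∷ [])) (α ∷ []) ≤-refl (here refl)
    ... | j , |Stab|≡2^j = j , trans (count-cong (λ h → h ⟨$⟩ʳ α ≟ α) (fixes? (α ∷ [])) N
                                   λ _ → (λ hα≡α → hα≡α ∷ []) , λ { (hα≡α ∷ []) → hα≡α })
                                 |Stab|≡2^j

EdgeSplitting : ∀ {n} → Adj n → ℕ → List (Perm n) → List (Perm n) → Set
EdgeSplitting {n} adj r G N = ∃ λ (c : Fin n → Fin n → Bool) →
  SymmetricColouring adj c
  × (∃ λ g → g ∈ₚ G × ¬ (g ∈ₚ N) × SwapsParts adj c g)
  × IsXArcTransitiveGraph (E₁-adj adj c) N × Regular (E₁-adj adj c) r
  × IsXArcTransitiveGraph (E₂-adj adj c) N × Regular (E₂-adj adj c) r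

-- Consequences of the vertex-transitivity of N: every arc is N-equivalent to
-- an arc starting at α, so global statements reduce to statements about Γ(α).
module Arcs {n : ℕ} (adj : Adj n) (r : ℕ) (G N : List (Perm n)) (α : Fin n)
            (pr : Prime r) (reg : Regular adj (2 * r)) (autG : AutGroup adj G)
            (atG : ArcTransitive adj G) (normal : IsNormalSubgroup N G) (vtN : VertexTransitive N) where

  open Suborbits adj r G N α pr reg autG atG normal public

  Arc₀ : Fin n → Fin n → Set
  Arc₀ = Orbital α β₀

  arc-at-α : ∀ {u v} → adj u v ≡ true → ∃ λ w → Neighbour w × Orbital α w u v
  arc-at-α {u} {v} u~v with vtN α u
  ... | h , h∈N , refl = flip h ⟨$⟩ʳ v , α~w , orbital-intro h h∈N refl (inverseʳ h)
    where
    α~w : Neighbour (flip h ⟨$⟩ʳ v)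
    α~w = trans (cong (λ x → adj x (flip h ⟨$⟩ʳ v)) (sym (inverseˡ h)))
                (trans (automorphism-of-N {flip h} (N.closed-⁻¹ {h} h∈N) (h ⟨$⟩ʳ α) v) u~v)

  edge-transitive-via-Arc₀ : (∀ {u v} → adj u v ≡ true → Arc₀ u v ⊎ Arc₀ v u) → EdgeTransitive adj N
  edge-transitive-via-Arc₀ oriented u v x y u~v x~y = relate (oriented u~v) (oriented x~y)
    where
    relate : Arc₀ u v ⊎ Arc₀ v u → Arc₀ x y ⊎ Arc₀ y x →
      ∃ λ h → h ∈ₚ N × ((h ⟨$⟩ʳ u ≡ x × h ⟨$⟩ʳ v ≡ y) ⊎ (h ⟨$⟩ʳ u ≡ y × h ⟨$⟩ʳ v ≡ x))
    relate (inj₁ o₁) (inj₁ o₂) = let (h , h∈N , hu , hv) = orbital-relate o₁ o₂ in h , h∈N , inj₁ (hu , hv)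
    relate (inj₁ o₁) (inj₂ o₂) = let (h , h∈N , hu , hv) = orbital-relate o₁ o₂ in h , h∈N , inj₂ (hu , hv)
    relate (inj₂ o₁) (inj₁ o₂) = let (h , h∈N , hv , hu) = orbital-relate o₁ o₂ in h , h∈N , inj₂ (hu , hv)
    relate (inj₂ o₁) (inj₂ o₂) = let (h , h∈N , hv , hu) = orbital-relate o₁ o₂ in h , h∈N , inj₁ (hu , hv)

  -- s = 2r: N_α is transitive on Γ(α), so N is even arc-transitive
  edge-transitive-if-s≡2r : s ≡ 2 * r → EdgeTransitive adj N
  edge-transitive-if-s≡2r s≡2r = edge-transitive-via-Arc₀ λ u~v → inj₁ (in-Arc₀ u~v)
    where
    Γ⊆suborbit : ∀ {w} → Neighbour w → Suborbit α β₀ w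
    Γ⊆suborbit = card-≡⇒⊇ (suborbit? α β₀) neighbour? (suborbit-neighbour β₀-neighbour) (trans s≡2r (sym (reg α)))
    in-Arc₀ : ∀ {u v} → adj u v ≡ true → Arc₀ u v
    in-Arc₀ u~v with arc-at-α u~v
    ... | w , α~w , o = orbital-trans (Γ⊆suborbit α~w) o

  regular-by-transitivity : (A : Adj n) → (∀ {h} → h ∈ₚ N → IsAutomorphism A h) →
    ∀ {p} {P : Pred (Fin n) p} (P? : Decidable P) → (∀ {x} → P x → A α x ≡ true) → (∀ {x} → A α x ≡ true → P x) →
    ∀ {k} → card P? ≡ k → Regular A k
  regular-by-transitivity A autA P? P⇒A A⇒P card≡k u with vtN α u
  ... | h , h∈N , refl = trans (sym (card-bijection P? (λ v → A (h ⟨$⟩ʳ α) v Bool.≟ true)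
          (h ⟨$⟩ʳ_) (flip h ⟨$⟩ʳ_) (λ _ → inverseˡ h) (λ _ → inverseʳ h)
          (λ x px → trans (autA {h} h∈N α x) (P⇒A px)) (λ x e → A⇒P (trans (sym (autA {h} h∈N α x)) e)))) card≡k

  module HalfCase (simple : IsSimpleGraph adj) (s≡r : s ≡ r) where

    Other : Fin n → Set
    Other x = Neighbour x × ¬ Suborbit α β₀ x

    other? : Decidable Other
    other? = neighbour? ∩? ∁? (suborbit? α β₀)

    card-other : card other? ≡ r
    card-other = +-cancelˡ-≡ r _ _ (begin
      r + card other?                                       ≡⟨ cong (_+ card other?) (sym (trans inside s≡r)) ⟩
      card (neighbour? ∩? suborbit? α β₀) + card other?     ≡⟨ sym (count-split neighbour? (suborbit? α β₀) (allFin n)) ⟩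
      card neighbour?                                       ≡⟨ reg α ⟩
      2 * r                                                 ≡⟨ cong (r +_) (+-identityʳ r) ⟩
      r + r                                                 ∎)
      where
      open ≡-Reasoning
      inside : card (neighbour? ∩? suborbit? α β₀) ≡ s
      inside = count-cong (neighbour? ∩? suborbit? α β₀) (suborbit? α β₀) (allFin n)
                 λ _ → proj₂ , λ o → suborbit-neighbour β₀-neighbour o , o

    opaque
      β₁ : Fin n
      β₁ = proj₁ (card-witness other? (subst (0 <_) (sym card-other) (p>0 pr)))

      β₁-other : Other β₁
      β₁-other = proj₂ (card-witness other? (subst (0 <_) (sym card-other) (p>0 pr)))

    Arc₁ : Fin n → Fin n → Set
    Arc₁ = Orbital α β₁

    -- the suborbit of β₁ has size s = r, so it consists of all the other neighbours
    other⊆suborbit₁ : ∀ {x} → Other x → Suborbit α β₁ x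
    other⊆suborbit₁ = card-≡⇒⊇ (suborbit? α β₁) other? suborbit₁⊆other
      (trans (suborbit-size (proj₁ β₁-other)) (trans s≡r (sym card-other)))
      where
      suborbit₁⊆other : ∀ {x} → Suborbit α β₁ x → Other x
      suborbit₁⊆other o = suborbit-neighbour (proj₁ β₁-other) o , λ o₀ → proj₂ β₁-other (orbital-trans o₀ (orbital-sym o))

    arc-dichotomy : ∀ {u v} → adj u v ≡ true → Arc₀ u v ⊎ Arc₁ u v
    arc-dichotomy u~v with arc-at-α u~v
    ... | w , α~w , o with suborbit? α β₀ w
    ...   | yes o₀ = inj₁ (orbital-trans o₀ o)
    ...   | no ¬o₀ = inj₂ (orbital-trans (other⊆suborbit₁ (α~w , ¬o₀)) o)

    arc-exclusive : ∀ {u v} → Arc₀ u v → Arc₁ u v → ⊥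
    arc-exclusive o₀ o₁ = proj₂ β₁-other (orbital-trans o₀ (orbital-sym o₁))

    -- if Arc₀ is not self-paired, then the reversed arc (β₀ , α) lies in Arc₁, so
    -- Arc₁ consists of the reversals of the arcs in Arc₀ and every edge has an
    -- orientation in Arc₀
    edge-transitive-if-not-self-paired : ¬ Arc₀ β₀ α → EdgeTransitive adj N
    edge-transitive-if-not-self-paired ¬self-paired = edge-transitive-via-Arc₀ oriented
      where
      reverse₀ : Arc₁ β₀ α
      reverse₀ with arc-dichotomy (trans (IsSimpleGraph.symmetric simple β₀ α) β₀-neighbour)
      ... | inj₁ o₀ = ⊥-elim (¬self-paired o₀)
      ... | inj₂ o₁ = o₁
      oriented : ∀ {u v} → adj u v ≡ true → Arc₀ u v ⊎ Arc₀ v u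
      oriented u~v with arc-dichotomy u~v
      ... | inj₁ o₀ = inj₁ o₀
      ... | inj₂ o₁ = inj₂ (orbital-swap (orbital-trans (orbital-sym reverse₀) o₁))

    module SelfPaired (self-paired : Arc₀ β₀ α) where

      -- E₁ consists of the edges in Arc₀, E₂ of those in Arc₁
      colour : Fin n → Fin n → Bool
      colour u v = does (orbital? α β₀ u v)

      colour-true : ∀ {u v} → Arc₀ u v → colour u v ≡ true
      colour-true o = dec-true (orbital? α β₀ _ _) o

      colour-false : ∀ {u v} → ¬ Arc₀ u v → colour u v ≡ false
      colour-false ¬o = dec-false (orbital? α β₀ _ _) ¬o

      -- since Arc₀ is self-paired, the colour does not depend on the orientation
      symmetric-colour : SymmetricColouring adj colour
      symmetric-colour u v _ = does-⇔ (mk⇔ reverse reverse) (orbital? α β₀ u v) (orbital? α β₀ v u)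
        where
        reverse : ∀ {x y} → Arc₀ x y → Arc₀ y x
        reverse o = orbital-trans self-paired (orbital-swap o)

      colour-invariant : ∀ {h} → h ∈ₚ N → ∀ u v → colour (h ⟨$⟩ʳ u) (h ⟨$⟩ʳ v) ≡ colour u v
      colour-invariant {h} h∈N u v = does-⇔ (mk⇔ back forth) (orbital? α β₀ _ _) (orbital? α β₀ u v)
        where
        forth : Arc₀ u v → Arc₀ (h ⟨$⟩ʳ u) (h ⟨$⟩ʳ v)
        forth o = orbital-trans o (orbital-intro h h∈N refl refl)
        back : Arc₀ (h ⟨$⟩ʳ u) (h ⟨$⟩ʳ v) → Arc₀ u v
        back o = orbital-trans o (orbital-intro (flip h) (N.closed-⁻¹ {h} h∈N) (inverseˡ h) (inverseˡ h))

      colour⇒Arc₀ : ∀ {u v} → colour u v ≡ true → Arc₀ u v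
      colour⇒Arc₀ {u} {v} e with orbital? α β₀ u v
      ... | yes o = o

      E₁⇒Arc₀ : ∀ {u v} → E₁-adj adj colour u v ≡ true → Arc₀ u v
      E₁⇒Arc₀ e = colour⇒Arc₀ (proj₂ (∧-true e))

      Arc₀⇒E₁ : ∀ {u v} → Arc₀ u v → E₁-adj adj colour u v ≡ true
      Arc₀⇒E₁ o = cong₂ _∧_ (trans (orbital-adj o) β₀-neighbour) (colour-true o)

      E₂⇒Arc₁ : ∀ {u v} → E₂-adj adj colour u v ≡ true → Arc₁ u v
      E₂⇒Arc₁ e with ∧-true e
      ... | u~v , not-colour with arc-dichotomy u~v
      ...   | inj₁ o₀ = ⊥-elim (Bool.not-¬ (colour-true o₀) (Bool.not-injective not-colour))
      ...   | inj₂ o₁ = o₁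

      Arc₁⇒E₂ : ∀ {u v} → Arc₁ u v → E₂-adj adj colour u v ≡ true
      Arc₁⇒E₂ o₁ = cong₂ _∧_ (trans (orbital-adj o₁) (proj₁ β₁-other))
                             (cong not (colour-false λ o₀ → arc-exclusive o₀ o₁))

      -- an element g ∈ G fixing α and mapping β₀ to β₁ (arc-transitivity of G);
      -- it interchanges the two orbitals, so it lies outside N
      opaque
        swapping-element : ∃ λ g → g ∈ₚ G × g ⟨$⟩ʳ α ≡ α × g ⟨$⟩ʳ β₀ ≡ β₁
        swapping-element = atG α β₀ α β₁ β₀-neighbour (proj₁ β₁-other)

      g : Perm n
      g = proj₁ swapping-element

      g∈G : g ∈ₚ G
      g∈G = proj₁ (proj₂ swapping-element)

      g-fixes-α : g ⟨$⟩ʳ α ≡ α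
      g-fixes-α = proj₁ (proj₂ (proj₂ swapping-element))

      g-maps-β₀ : g ⟨$⟩ʳ β₀ ≡ β₁
      g-maps-β₀ = proj₂ (proj₂ (proj₂ swapping-element))

      g-maps-Arc₀ : ∀ {u v} → Arc₀ u v → Arc₁ (g ⟨$⟩ʳ u) (g ⟨$⟩ʳ v)
      g-maps-Arc₀ {u} {v} o =
        subst₂ (λ a b → Orbital a b (g ⟨$⟩ʳ u) (g ⟨$⟩ʳ v)) g-fixes-α g-maps-β₀ (orbital-conj {g} g∈G o)

      g-reflects-Arc₀ : ∀ {u v} → Arc₁ (g ⟨$⟩ʳ u) (g ⟨$⟩ʳ v) → Arc₀ u v
      g-reflects-Arc₀ {u} {v} o = orbital-conj⁻¹ {g} g∈G
        (subst₂ (λ a b → Orbital a b (g ⟨$⟩ʳ u) (g ⟨$⟩ʳ v)) (sym g-fixes-α) (sym g-maps-β₀) o)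

      g∉N : ¬ (g ∈ₚ N)
      g∉N g∈N = arc-exclusive (orbital-intro g g∈N refl refl) (g-maps-Arc₀ orbital-refl)

      g-swaps : SwapsParts adj colour g
      g-swaps u v u~v with orbital? α β₀ u v
      ... | yes o₀ = colour-false λ o₀′ → arc-exclusive o₀′ (g-maps-Arc₀ o₀)
      ... | no ¬o₀ with arc-dichotomy (trans (proj₂ autG {g} g∈G u v) u~v)
      ...   | inj₁ o₀′ = colour-true o₀′
      ...   | inj₂ o₁  = ⊥-elim (¬o₀ (g-reflects-Arc₀ o₁))

      E₁-automorphism : ∀ {h} → h ∈ₚ N → IsAutomorphism (E₁-adj adj colour) h
      E₁-automorphism {h} h∈N u v = cong₂ _∧_ (automorphism-of-N {h} h∈N u v) (colour-invariant {h} h∈N u v)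

      E₂-automorphism : ∀ {h} → h ∈ₚ N → IsAutomorphism (E₂-adj adj colour) h
      E₂-automorphism {h} h∈N u v =
        cong₂ _∧_ (automorphism-of-N {h} h∈N u v) (cong not (colour-invariant {h} h∈N u v))

      -- each part is N-arc-transitive, being a single orbital of N ...
      E₁-graph : IsXArcTransitiveGraph (E₁-adj adj colour) N
      E₁-graph = (λ {h} → E₁-automorphism {h}) , λ u v x y e₁ e₂ → orbital-relate (E₁⇒Arc₀ e₁) (E₁⇒Arc₀ e₂)

      E₂-graph : IsXArcTransitiveGraph (E₂-adj adj colour) N
      E₂-graph = (λ {h} → E₂-automorphism {h}) , λ u v x y e₁ e₂ → orbital-relate (E₂⇒Arc₁ e₁) (E₂⇒Arc₁ e₂)

      -- ... and has valency r, the size of the suborbits of β₀ and β₁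
      E₁-regular : Regular (E₁-adj adj colour) r
      E₁-regular = regular-by-transitivity (E₁-adj adj colour) (λ {h} → E₁-automorphism {h})
                     (suborbit? α β₀) Arc₀⇒E₁ E₁⇒Arc₀ s≡r

      E₂-regular : Regular (E₂-adj adj colour) r
      E₂-regular = regular-by-transitivity (E₂-adj adj colour) (λ {h} → E₂-automorphism {h})
                     (suborbit? α β₁) Arc₁⇒E₂ E₂⇒Arc₁ (trans (suborbit-size (proj₁ β₁-other)) s≡r)

      splitting : EdgeSplitting adj r G N
      splitting = colour , symmetric-colour , (g , g∈G , g∉N , g-swaps) , E₁-graph , E₁-regular , E₂-graph , E₂-regular

    half-case : EdgeTransitive adj N ⊎ EdgeSplitting adj r G N
    half-case with orbital? α β₀ β₀ α
    ... | yes self-paired = inj₂ (SelfPaired.splitting self-paired)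
    ... | no ¬self-paired = inj₁ (edge-transitive-if-not-self-paired ¬self-paired)

corollary3p2 : ∀ {n : ℕ} (adj : Adj n) (r : ℕ) (G N : List (Perm n)) (α : Fin n) →
    IsSimpleGraph adj → Connected adj → Prime r → Regular adj (2 * r) →
    AutGroup adj G → VertexTransitive G → EdgeTransitive adj G →
    ¬ TwoArcTransitive adj G → ArcTransitive adj G →
    IsNormalSubgroup N G → VertexTransitive N →
    (Is2Group (stabiliser N α) ⊎ EdgeTransitive adj N)
    ⊎ (∃ λ (c : Fin n → Fin n → Bool) →
         SymmetricColouring adj c
         × (∃ λ g → g ∈ₚ G × ¬ (g ∈ₚ N) × SwapsParts adj c g)
         × IsXArcTransitiveGraph (E₁-adj adj c) N × Regular (E₁-adj adj c) r
         × IsXArcTransitiveGraph (E₂-adj adj c) N × Regular (E₂-adj adj c) r)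
corollary3p2 adj r G N α simple connected pr reg autG _ _ _ atG normal vtN = by-size (s ≤? 2)
  where
  open Arcs adj r G N α pr reg autG atG normal vtN

  Conclusion : Set
  Conclusion = (Is2Group (stabiliser N α) ⊎ EdgeTransitive adj N) ⊎ EdgeSplitting adj r G N

  by-divisor : s ≡ r ⊎ s ≡ 2 * r → Conclusion
  by-divisor (inj₁ s≡r)  = Sum.map₁ inj₂ (HalfCase.half-case simple s≡r)
  by-divisor (inj₂ s≡2r) = inj₁ (inj₂ (edge-transitive-if-s≡2r s≡2r))

  by-size : Dec (s ≤ 2) → Conclusion
  by-size (yes s≤2) = inj₁ (inj₁ (TwoGroupCase.two-group connected s≤2))
  by-size (no s≰2)  = by-divisor (large-divisor-of-2p pr s∣2r (≰⇒> s≰2))
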